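{- For a partition $\lambda$ define \[ \mathrm{wt}_{\mathbb{Z}_3}(\lambda)=\left|\{\square\in\lambda : l(\square)>0 \text{ and } a(\square)+1\equiv l(\square) \pmod 3\}\right|,\qquad \widetilde{\mathrm{wt}}_{\mathbb{Z}_3}(\lambda)=\left|\{\square\in\lambda : a(\square)+1\equiv l(\square) \pmod 3\}\right|. \] Then, as formal power series in $q,t$, with sums over all partitions $\lambda$ (including the empty one), \[ \sum_{\lambda}q^{|\lambda|}t^{\widetilde{\mathrm{wt}}_{\mathbb{Z}_3}(\lambda)}=\left(\prod_{m\ge 1}\frac{1-t^{m-1}q^{3m}}{1-t^{m}q^{3m}}\right)\sum_{\lambda}q^{|\lambda|}t^{\mathrm{wt}_{\mathbb{Z}_3}(\lambda)}. \]
   Context: Partitions are represented by southwest-justified Young diagrams (French convention): a partition $\lambda=(\lambda_1\ge\lambda_2\ge\cdots\ge\lambda_\ell>0)$ has $\lambda_r$ boxes in its $r$-th row from the bottom. $|\lambda|$ is the number of boxes. For a box $\square\in\lambda$, the arm $a(\square)$ is the number of boxes of $\lambda$ strictly above $\square$ in its column, and the leg $l(\square)$ is the number of boxes of $\lambda$ strictly to the right of $\square$ in its row. -}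

module Defs where

open import Data.Nat as ℕ using (ℕ; zero; suc; _∸_; _≡ᵇ_; _<ᵇ_; _≤ᵇ_; _%_)
open import Data.Integer as ℤ using (ℤ; +_; -_)
open import Data.List using (List; []; _∷_; map; _++_; length; upTo; concatMap; drop)
open import Data.Product using (_×_; _,_)
open import Data.Bool using (Bool; true; false; if_then_else_; _∧_)

-- Partitions (lists of positive, weakly decreasing parts, λ₁ first)

-- parts n m fuel : all partitions of n with all parts ≤ m
-- (fuel ≥ n guarantees completeness since every step removes ≥ 1 box)
partsF : ℕ → ℕ → ℕ → List (List ℕ)
partsF zero    m f       = [] ∷ []
partsF (suc n) m zero    = []
partsF (suc n) m (suc f) =
  concatMap (λ p → map (p ∷_) (partsF (suc n ∸ p) p f))
            (map suc (upTo (ℕ._⊓_ m (suc n))))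

partitions : ℕ → List (List ℕ)
partitions n = partsF n n n

-- Arm and leg (French convention).  The row list is λ₁ ∷ λ₂ ∷ …, row r
-- from the bottom.  For the box in row r, column c (1 ≤ c ≤ λ_r):
--   arm = #{ r' > r : λ_{r'} ≥ c }   (boxes strictly above, same column)
--   leg = λ_r - c                    (boxes strictly to the right)

count : {A : Set} → (A → Bool) → List A → ℕ
count p []       = 0
count p (x ∷ xs) = if p x then suc (count p xs) else count p xs

armLegs : List ℕ → List (ℕ × ℕ)
armLegs []         = []
armLegs (r ∷ rest) =
  map (λ c → count (λ x → c ≤ᵇ x) rest , r ∸ c) (map suc (upTo r))
  ++ armLegs rest

cond3 : ℕ × ℕ → Bool
cond3 (a , l) = (suc a % 3) ≡ᵇ (l % 3)

wtZ3 : List ℕ → ℕ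
wtZ3 λ' = count (λ { (a , l) → (0 <ᵇ l) ∧ cond3 (a , l) }) (armLegs λ')

wtZ3~ : List ℕ → ℕ
wtZ3~ λ' = count cond3 (armLegs λ')

-- Formal power series in q, t over ℤ:  F i j = coefficient of q^i t^j

PS : Set
PS = ℕ → ℕ → ℤ

sumTo : ℕ → (ℕ → ℤ) → ℤ
sumTo zero    f = f 0
sumTo (suc n) f = sumTo n f ℤ.+ f (suc n)

tmul : (ℕ → ℤ) → (ℕ → ℤ) → (ℕ → ℤ)
tmul f g k = sumTo k (λ b → f b ℤ.* g (k ∸ b))

_⊛_ : PS → PS → PS
(F ⊛ G) n k = sumTo n (λ a → tmul (F a) (G (n ∸ a)) k)

_⊝_ : PS → PS → PS
(F ⊝ G) n k = F n k ℤ.- G n k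

mono : ℕ → ℕ → PS
mono i j n k = if (n ≡ᵇ i) ∧ (k ≡ᵇ j) then + 1 else + 0

one : PS
one = mono 0 0

-- Multiplicative inverse of a series F whose q^0-coefficient is 1:
-- G₀ = 1,  G_n = - Σ_{a=1}^{n} F_a G_{n-a}.
-- invRows F n = [G_n , G_{n-1} , … , G_0]
lookupD : List (ℕ → ℤ) → ℕ → (ℕ → ℤ)
lookupD []       _       = λ _ → + 0
lookupD (x ∷ xs) zero    = x
lookupD (x ∷ xs) (suc i) = lookupD xs i

invRows : PS → ℕ → List (ℕ → ℤ)
invRows F zero    = (λ k → if k ≡ᵇ 0 then + 1 else + 0) ∷ []
invRows F (suc n) = new ∷ prev
  where
  prev : List (ℕ → ℤ)
  prev = invRows F n
  G : ℕ → (ℕ → ℤ)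
  G j = lookupD prev (n ∸ j)
  new : ℕ → ℤ
  new k = - sumTo (suc n)
            (λ a → if a ≡ᵇ 0 then + 0 else tmul (F a) (G (suc n ∸ a)) k)

inv : PS → PS
inv F n = lookupD (invRows F n) 0

factor : ℕ → PS
factor m = (one ⊝ mono (3 ℕ.* m) (m ∸ 1)) ⊛ inv (one ⊝ mono (3 ℕ.* m) m)

prodTo : ℕ → PS
prodTo zero    = one
prodTo (suc N) = prodTo N ⊛ factor (suc N)

-- infinite product ∏_{m≥1} factor m : since factor m ≡ 1 mod q^{3m},
-- its q^n-coefficient equals that of the finite product up to m = n.
infProd : PS
infProd n k = prodTo n n k

genSeries : (List ℕ → ℕ) → PS
genSeries w n k = + count (λ lam → w lam ≡ᵇ k) (partitions n)

-- For a weight w, let H_M(w) = Σ q^|λ| t^w(λ) over the partitions λ in which no part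
-- larger than M occurs three or more times.  Inserting three rows of length M is a
-- bijection from all partitions onto those in which M occurs at least three times.  It
-- adds 3M boxes; it adds 3 to the arms of the boxes below it in its M columns, which does
-- not change a(□) + 1 ≡ l(□) (mod 3); and in each of its columns the three new boxes have
-- arms a + 2, a + 1, a and a common leg, so exactly one of them is counted.  Hence the
-- insertion raises wt~ by M and wt by M - 1 (the last column has leg 0), so that
--   (1 - q^{3M} t^M) H_M(wt~) = H_{M-1}(wt~)  and  (1 - q^{3M} t^{M-1}) H_M(wt) = H_{M-1}(wt).
-- The two weights agree on the partitions counted by H_0: a box of leg 0 ends its row, so
-- its arm counts the rows of equal length above it, which is at most 1.  Telescoping gives
-- (∏_{m ≤ N} factor m) H_N(wt) = H_N(wt~), and H_N agrees with the full series up to q^N.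

module Submission where

open import Defs
open import Algebra.Bundles using (CommutativeRing)
open import Data.Bool using (Bool; true; false; if_then_else_; T)
open import Data.Bool.Properties using (T-≡)
open import Data.Empty using (⊥-elim)
open import Data.Nat as ℕ using (ℕ; zero; suc; _∸_; _≤_; _<_; z≤n; s≤s; _≡ᵇ_; _≤ᵇ_)
import Data.Nat.Properties as ℕ
open import Data.Product using (_,_)
open import Data.Sum using (inj₁; inj₂)
open import Function using (Equivalence)
open import Relation.Binary using (tri<; tri≈; tri>)
open import Relation.Binary.PropositionalEquality as ≡ using (_≡_)
open import Relation.Nullary using (¬_; yes; no)

T⇒≡true : ∀ {b} → T b → b ≡ true
T⇒≡true = Equivalence.to T-≡

¬T⇒≡false : ∀ {b} → ¬ T b → b ≡ false
¬T⇒≡false {true}  ¬t = ⊥-elim (¬t _)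
¬T⇒≡false {false} _  = ≡.refl

≡ᵇ-refl : ∀ n → (n ≡ᵇ n) ≡ true
≡ᵇ-refl n = T⇒≡true (ℕ.≡⇒≡ᵇ n n ≡.refl)

≢⇒≡ᵇ≡false : ∀ {m n} → ¬ m ≡ n → (m ≡ᵇ n) ≡ false
≢⇒≡ᵇ≡false {m} {n} m≢n = ¬T⇒≡false (λ t → m≢n (ℕ.≡ᵇ⇒≡ m n t))

≤⇒≤ᵇ≡true : ∀ {m n} → m ≤ n → (m ≤ᵇ n) ≡ true
≤⇒≤ᵇ≡true m≤n = T⇒≡true (ℕ.≤⇒≤ᵇ m≤n)

>⇒≤ᵇ≡false : ∀ {m n} → n < m → (m ≤ᵇ n) ≡ false
>⇒≤ᵇ≡false {m} {n} n<m = ¬T⇒≡false (λ t → ℕ.<⇒≱ n<m (ℕ.≤ᵇ⇒≤ m n t))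

module PowerSeries {c ℓ} (R : CommutativeRing c ℓ) where

  open CommutativeRing R
  open import Algebra.Properties.CommutativeSemigroup +-commutativeSemigroup using (interchange)
  open import Relation.Binary.Reasoning.Setoid setoid

  ∑ : ℕ → (ℕ → Carrier) → Carrier
  ∑ zero    f = f 0
  ∑ (suc n) f = ∑ n f + f (suc n)

  ∑-cong : ∀ n {f g} → (∀ a → a ≤ n → f a ≈ g a) → ∑ n f ≈ ∑ n g
  ∑-cong zero    f≈g = f≈g 0 z≤n
  ∑-cong (suc n) f≈g =
    +-cong (∑-cong n (λ a a≤n → f≈g a (ℕ.m≤n⇒m≤1+n a≤n))) (f≈g (suc n) ℕ.≤-refl)

  ∑-cong′ : ∀ n {f g} → (∀ a → f a ≈ g a) → ∑ n f ≈ ∑ n g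
  ∑-cong′ n f≈g = ∑-cong n (λ a _ → f≈g a)

  ∑-zero : ∀ n → ∑ n (λ _ → 0#) ≈ 0#
  ∑-zero zero    = refl
  ∑-zero (suc n) = trans (+-identityʳ _) (∑-zero n)

  ∑-distrib-+ : ∀ n f g → ∑ n (λ a → f a + g a) ≈ ∑ n f + ∑ n g
  ∑-distrib-+ zero    f g = refl
  ∑-distrib-+ (suc n) f g = begin
    ∑ n (λ a → f a + g a) + (f (suc n) + g (suc n)) ≈⟨ +-congʳ (∑-distrib-+ n f g) ⟩
    (∑ n f + ∑ n g) + (f (suc n) + g (suc n))       ≈⟨ interchange _ _ _ _ ⟩
    (∑ n f + f (suc n)) + (∑ n g + g (suc n))       ∎

  *-distribˡ-∑ : ∀ n x f → x * ∑ n f ≈ ∑ n (λ a → x * f a)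
  *-distribˡ-∑ zero    x f = refl
  *-distribˡ-∑ (suc n) x f = trans (distribˡ x (∑ n f) (f (suc n))) (+-congʳ (*-distribˡ-∑ n x f))

  *-distribʳ-∑ : ∀ n x f → ∑ n f * x ≈ ∑ n (λ a → f a * x)
  *-distribʳ-∑ zero    x f = refl
  *-distribʳ-∑ (suc n) x f = trans (distribʳ x (∑ n f) (f (suc n))) (+-congʳ (*-distribʳ-∑ n x f))

  ∑-suc : ∀ n f → ∑ (suc n) f ≈ f 0 + ∑ n (λ a → f (suc a))
  ∑-suc zero    f = refl
  ∑-suc (suc n) f = trans (+-congʳ (∑-suc n f)) (+-assoc _ _ _)

  ∑-reverse : ∀ n f → ∑ n f ≈ ∑ n (λ a → f (n ∸ a))
  ∑-reverse zero    f = refl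
  ∑-reverse (suc n) f = begin
    ∑ n f + f (suc n)                  ≈⟨ +-comm _ _ ⟩
    f (suc n) + ∑ n f                  ≈⟨ +-congˡ (∑-reverse n f) ⟩
    f (suc n) + ∑ n (λ a → f (n ∸ a))  ≈⟨ sym (∑-suc n (λ a → f (suc n ∸ a))) ⟩
    ∑ (suc n) (λ a → f (suc n ∸ a))    ∎

  ∑-triangle : ∀ n (g : ℕ → ℕ → Carrier) →
    ∑ n (λ k → ∑ k (λ a → g a (k ∸ a))) ≈ ∑ n (λ a → ∑ (n ∸ a) (g a))
  ∑-triangle zero    g = refl
  ∑-triangle (suc n) g = begin
    ∑ (suc n) (λ k → ∑ k (λ a → g a (k ∸ a)))
      ≈⟨ ∑-suc n _ ⟩
    g 0 0 + ∑ n (λ k → ∑ (suc k) (λ a → g a (suc k ∸ a)))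
      ≈⟨ +-congˡ (∑-cong′ n (λ k → ∑-suc k _)) ⟩
    g 0 0 + ∑ n (λ k → g 0 (suc k) + ∑ k (λ a → g (suc a) (k ∸ a)))
      ≈⟨ +-congˡ (∑-distrib-+ n _ _) ⟩
    g 0 0 + (∑ n (λ k → g 0 (suc k)) + ∑ n (λ k → ∑ k (λ a → g (suc a) (k ∸ a))))
      ≈⟨ sym (+-assoc _ _ _) ⟩
    (g 0 0 + ∑ n (λ k → g 0 (suc k))) + ∑ n (λ k → ∑ k (λ a → g (suc a) (k ∸ a)))
      ≈⟨ +-cong (sym (∑-suc n (g 0))) (∑-triangle n (λ a → g (suc a))) ⟩
    ∑ (suc n) (g 0) + ∑ n (λ a → ∑ (n ∸ a) (g (suc a)))
      ≈⟨ sym (∑-suc n _) ⟩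
    ∑ (suc n) (λ a → ∑ (suc n ∸ a) (g a)) ∎

  single : ℕ → Carrier → ℕ → Carrier
  single i x a = if a ≡ᵇ i then x else 0#

  if-true : ∀ {b} {x y : Carrier} → b ≡ true → (if b then x else y) ≈ x
  if-true ≡.refl = refl

  if-false : ∀ {b} {x y : Carrier} → b ≡ false → (if b then x else y) ≈ y
  if-false ≡.refl = refl

  ∑-single : ∀ n i (f : ℕ → Carrier) → ∑ n (λ a → if a ≡ᵇ i then f a else 0#) ≈ (if i ≤ᵇ n then f i else 0#)
  ∑-single zero    zero    f = refl
  ∑-single zero    (suc i) f = refl
  ∑-single (suc n) i f with ℕ.<-cmp i (suc n)
  ... | tri< (s≤s i≤n) _ _ = begin
    ∑ n (λ a → if a ≡ᵇ i then f a else 0#) + (if suc n ≡ᵇ i then f (suc n) else 0#)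
      ≈⟨ +-cong (trans (∑-single n i f) (if-true (≤⇒≤ᵇ≡true i≤n)))
                (if-false (≢⇒≡ᵇ≡false (λ 1+n≡i → ℕ.<⇒≢ (s≤s i≤n) (≡.sym 1+n≡i)))) ⟩
    f i + 0#                             ≈⟨ +-identityʳ _ ⟩
    f i                                  ≈⟨ if-true (≤⇒≤ᵇ≡true (ℕ.m≤n⇒m≤1+n i≤n)) ⟨
    (if i ≤ᵇ suc n then f i else 0#)     ∎
  ... | tri≈ _ ≡.refl _ = begin
    ∑ n (λ a → if a ≡ᵇ suc n then f a else 0#) + (if suc n ≡ᵇ suc n then f (suc n) else 0#)
      ≈⟨ +-cong (trans (∑-single n (suc n) f) (if-false (>⇒≤ᵇ≡false (ℕ.n<1+n n))))
                (if-true (≡ᵇ-refl (suc n))) ⟩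
    0# + f (suc n)                                   ≈⟨ +-identityˡ _ ⟩
    f (suc n)                                        ≈⟨ if-true (≤⇒≤ᵇ≡true (ℕ.≤-refl {suc n})) ⟨
    (if suc n ≤ᵇ suc n then f (suc n) else 0#)       ∎
  ... | tri> _ _ 1+n<i = begin
    ∑ n (λ a → if a ≡ᵇ i then f a else 0#) + (if suc n ≡ᵇ i then f (suc n) else 0#)
      ≈⟨ +-cong (trans (∑-single n i f) (if-false (>⇒≤ᵇ≡false (ℕ.<-trans (ℕ.n<1+n n) 1+n<i))))
                (if-false (≢⇒≡ᵇ≡false (ℕ.<⇒≢ 1+n<i))) ⟩
    0# + 0#                              ≈⟨ +-identityʳ _ ⟩
    0#                                   ≈⟨ if-false (>⇒≤ᵇ≡false 1+n<i) ⟨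
    (if i ≤ᵇ suc n then f i else 0#)     ∎

  infixl 7 _⋆_
  _⋆_ : (ℕ → Carrier) → (ℕ → Carrier) → ℕ → Carrier
  (f ⋆ g) n = ∑ n (λ a → f a * g (n ∸ a))

  δ : ℕ → Carrier
  δ zero    = 1#
  δ (suc _) = 0#

  ⋆-cong≤ : ∀ {f f′ g g′} N → (∀ a → a ≤ N → f a ≈ f′ a) → (∀ a → a ≤ N → g a ≈ g′ a) →
            ∀ n → n ≤ N → (f ⋆ g) n ≈ (f′ ⋆ g′) n
  ⋆-cong≤ N f≈f′ g≈g′ n n≤N = ∑-cong n (λ a a≤n →
    *-cong (f≈f′ a (ℕ.≤-trans a≤n n≤N)) (g≈g′ (n ∸ a) (ℕ.≤-trans (ℕ.m∸n≤m n a) n≤N)))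

  ⋆-comm : ∀ f g n → (f ⋆ g) n ≈ (g ⋆ f) n
  ⋆-comm f g n = trans (∑-reverse n _) (∑-cong n (λ a a≤n →
    trans (*-comm _ _) (*-congʳ (reflexive (≡.cong g (ℕ.m∸[m∸n]≡n a≤n))))))

  ⋆-assoc : ∀ f g h n → ((f ⋆ g) ⋆ h) n ≈ (f ⋆ (g ⋆ h)) n
  ⋆-assoc f g h n = begin
    ∑ n (λ k → ∑ k (λ a → f a * g (k ∸ a)) * h (n ∸ k))
      ≈⟨ ∑-cong′ n (λ k → *-distribʳ-∑ k _ _) ⟩
    ∑ n (λ k → ∑ k (λ a → f a * g (k ∸ a) * h (n ∸ k)))
      ≈⟨ ∑-cong n (λ k _ → ∑-cong k (λ a a≤k → *-congˡ (reflexive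
           (≡.cong (λ m → h (n ∸ m)) (≡.sym (ℕ.m+[n∸m]≡n a≤k)))))) ⟩
    ∑ n (λ k → ∑ k (λ a → term a (k ∸ a)))
      ≈⟨ ∑-triangle n term ⟩
    ∑ n (λ a → ∑ (n ∸ a) (term a))
      ≈⟨ ∑-cong′ n (λ a → ∑-cong′ (n ∸ a) (λ b → trans (*-assoc _ _ _)
           (*-congˡ (*-congˡ (reflexive (≡.cong h (≡.sym (ℕ.∸-+-assoc n a b)))))))) ⟩
    ∑ n (λ a → ∑ (n ∸ a) (λ b → f a * (g b * h (n ∸ a ∸ b))))
      ≈⟨ ∑-cong′ n (λ a → sym (*-distribˡ-∑ (n ∸ a) _ _)) ⟩
    ∑ n (λ a → f a * ∑ (n ∸ a) (λ b → g b * h (n ∸ a ∸ b))) ∎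
    where
    term : ℕ → ℕ → Carrier
    term a b = f a * g b * h (n ∸ (a ℕ.+ b))

  ⋆-identityˡ : ∀ f n → (δ ⋆ f) n ≈ f n
  ⋆-identityˡ f zero    = *-identityˡ _
  ⋆-identityˡ f (suc n) = begin
    ∑ (suc n) (λ a → δ a * f (suc n ∸ a))        ≈⟨ ∑-suc n _ ⟩
    1# * f (suc n) + ∑ n (λ a → 0# * f (n ∸ a))  ≈⟨ +-cong (*-identityˡ _) (∑-cong′ n (λ _ → zeroˡ _)) ⟩
    f (suc n) + ∑ n (λ _ → 0#)                   ≈⟨ +-congˡ (∑-zero n) ⟩
    f (suc n) + 0#                               ≈⟨ +-identityʳ _ ⟩
    f (suc n)                                    ∎

  ⋆-distribˡ-+ : ∀ f g h n → (f ⋆ (λ m → g m + h m)) n ≈ (f ⋆ g) n + (f ⋆ h) n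
  ⋆-distribˡ-+ f g h n = trans (∑-cong′ n (λ _ → distribˡ _ _ _)) (∑-distrib-+ n _ _)

  single-⋆ : ∀ i x f n → (single i x ⋆ f) n ≈ (if i ≤ᵇ n then x * f (n ∸ i) else 0#)
  single-⋆ i x f n = trans (∑-cong′ n term) (∑-single n i (λ a → x * f (n ∸ a)))
    where
    term : ∀ a → single i x a * f (n ∸ a) ≈ (if a ≡ᵇ i then x * f (n ∸ a) else 0#)
    term a with a ≡ᵇ i
    ... | true  = refl
    ... | false = zeroˡ _

  seriesRing : CommutativeRing c ℓ
  seriesRing = record
    { Carrier = ℕ → Carrier
    ; _≈_     = λ f g → ∀ n → f n ≈ g n
    ; _+_     = λ f g n → f n + g n
    ; _*_     = _⋆_
    ; -_      = λ f n → - f n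
    ; 0#      = λ _ → 0#
    ; 1#      = δ
    ; isCommutativeRing = record
      { isRing = record
        { +-isAbelianGroup = record
          { isGroup = record
            { isMonoid = record
              { isSemigroup = record
                { isMagma = record
                  { isEquivalence = record
                    { refl = λ n → refl ; sym = λ p n → sym (p n) ; trans = λ p q n → trans (p n) (q n) }
                  ; ∙-cong = λ p q n → +-cong (p n) (q n) }
                ; assoc = λ f g h n → +-assoc (f n) (g n) (h n) }
              ; identity = (λ f n → +-identityˡ (f n)) , (λ f n → +-identityʳ (f n)) }
            ; inverse = (λ f n → -‿inverseˡ (f n)) , (λ f n → -‿inverseʳ (f n))
            ; ⁻¹-cong = λ p n → -‿cong (p n) }
          ; comm = λ f g n → +-comm (f n) (g n) }
        ; *-cong = λ p q n → ⋆-cong≤ n (λ a _ → p a) (λ a _ → q a) n ℕ.≤-refl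
        ; *-assoc = ⋆-assoc
        ; *-identity = ⋆-identityˡ , (λ f n → trans (⋆-comm f δ n) (⋆-identityˡ f n))
        ; distrib = ⋆-distribˡ-+
                  , (λ f g h n → trans (⋆-comm (λ m → g m + h m) f n)
                       (trans (⋆-distribˡ-+ f g h n) (+-cong (⋆-comm f g n) (⋆-comm f h n))))
        }
      ; *-comm = ⋆-comm
      }
    }

module Combinatorics where

  open import Data.Bool using (_∧_; _∨_; not)
  open import Data.Bool.Properties using (∧-assoc; ∧-zeroʳ)
  open import Data.List using (List; []; _∷_; map; _++_; upTo; concatMap; applyUpTo)
  open import Data.List.Properties using (map-applyUpTo)
  open import Algebra.Properties.CommutativeSemigroup ℕ.+-commutativeSemigroup using (interchange; x∙yz≈y∙xz)
  open import Data.Nat using (_+_; _*_; _⊓_; _<ᵇ_)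
  open import Data.Nat.DivMod using (_%_; %-distribˡ-+; [m+n]%n≡m%n; m%n<n)
  open import Data.Nat.Tactic.RingSolver using (solve-∀)
  open import Data.Product using (_×_)
  open ≡ using (refl; cong; cong₂; sym; trans; subst)
  open ≡.≡-Reasoning

  𝟙 : Bool → ℕ
  𝟙 b = if b then 1 else 0

  count-++ : ∀ {A : Set} (p : A → Bool) xs ys → count p (xs ++ ys) ≡ count p xs + count p ys
  count-++ p []       ys = refl
  count-++ p (x ∷ xs) ys with p x
  ... | true  = cong suc (count-++ p xs ys)
  ... | false = count-++ p xs ys

  count-map : ∀ {A B : Set} (p : B → Bool) (f : A → B) xs →
              count p (map f xs) ≡ count (λ x → p (f x)) xs
  count-map p f []       = refl
  count-map p f (x ∷ xs) with p (f x)
  ... | true  = cong suc (count-map p f xs)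
  ... | false = count-map p f xs

  count-cong : ∀ {A : Set} {p q : A → Bool} xs → (∀ x → p x ≡ q x) → count p xs ≡ count q xs
  count-cong []       p≡q = refl
  count-cong {p = p} {q} (x ∷ xs) p≡q with p x | q x | p≡q x
  ... | true  | true  | _ = cong suc (count-cong xs p≡q)
  ... | false | false | _ = count-cong xs p≡q

  count-false : ∀ {A : Set} (xs : List A) → count (λ _ → false) xs ≡ 0
  count-false []       = refl
  count-false (x ∷ xs) = count-false xs

  count-split : ∀ {A : Set} (p q : A → Bool) xs →
    count p xs ≡ count (λ x → not (q x) ∧ p x) xs + count (λ x → q x ∧ p x) xs
  count-split p q []       = refl
  count-split p q (x ∷ xs) with q x | p x
  ... | true  | true  = trans (cong suc (count-split p q xs)) (sym (ℕ.+-suc _ _))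
  ... | true  | false = count-split p q xs
  ... | false | true  = cong suc (count-split p q xs)
  ... | false | false = count-split p q xs

  sum< : ℕ → (ℕ → ℕ) → ℕ
  sum< zero    f = 0
  sum< (suc k) f = f 0 + sum< k (λ i → f (suc i))

  sum<-cong : ∀ k {f g} → (∀ i → i < k → f i ≡ g i) → sum< k f ≡ sum< k g
  sum<-cong zero    f≡g = refl
  sum<-cong (suc k) f≡g = cong₂ _+_ (f≡g 0 (s≤s z≤n)) (sum<-cong k (λ i i<k → f≡g (suc i) (s≤s i<k)))

  sum<-suc : ∀ k f → sum< (suc k) f ≡ sum< k f + f k
  sum<-suc zero    f = ℕ.+-comm (f 0) 0
  sum<-suc (suc k) f = trans (cong (f 0 +_) (sum<-suc k (λ i → f (suc i)))) (sym (ℕ.+-assoc (f 0) _ _))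

  sum<-distrib-+ : ∀ k f g → sum< k (λ i → f i + g i) ≡ sum< k f + sum< k g
  sum<-distrib-+ zero    f g = refl
  sum<-distrib-+ (suc k) f g =
    trans (cong ((f 0 + g 0) +_) (sum<-distrib-+ k _ _)) (interchange (f 0) (g 0) _ _)

  sum<-const1 : ∀ k → sum< k (λ _ → 1) ≡ k
  sum<-const1 zero    = refl
  sum<-const1 (suc k) = cong suc (sum<-const1 k)

  count-applyUpTo : ∀ {A : Set} (p : A → Bool) h k →
                    count p (applyUpTo h k) ≡ sum< k (λ i → 𝟙 (p (h i)))
  count-applyUpTo p h zero    = refl
  count-applyUpTo p h (suc k) with p (h 0)
  ... | true  = cong suc (count-applyUpTo p (λ i → h (suc i)) k)
  ... | false = count-applyUpTo p (λ i → h (suc i)) k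

  count-concatMap : ∀ {A B : Set} (p : B → Bool) (G : A → List B) h k →
    count p (concatMap G (applyUpTo h k)) ≡ sum< k (λ i → count p (G (h i)))
  count-concatMap p G h zero    = refl
  count-concatMap p G h (suc k) = trans (count-++ p (G (h 0)) _)
    (cong (count p (G (h 0)) +_) (count-concatMap p G (λ i → h (suc i)) k))

  -- Partitions with bounded parts

  Pred : Set
  Pred = List ℕ → Bool

  countPartsF : Pred → ℕ → ℕ → ℕ → ℕ
  countPartsF Q n m fuel = count Q (partsF n m fuel)

  countParts : Pred → ℕ → ℕ → ℕ
  countParts Q n m = countPartsF Q n m n

  data IsPartition : ℕ → ℕ → List ℕ → Set where
    nil  : ∀ {m} → IsPartition 0 m []
    cons : ∀ {n m i l} → suc i ≤ m → IsPartition n (suc i) l → IsPartition (suc i + n) m (suc i ∷ l)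

  IsPartition-weaken : ∀ {n m m′ l} → m ≤ m′ → IsPartition n m l → IsPartition n m′ l
  IsPartition-weaken m≤m′ nil            = nil
  IsPartition-weaken m≤m′ (cons 1+i≤m p) = cons (ℕ.≤-trans 1+i≤m m≤m′) p

  countPartsF-suc : ∀ Q n m fuel → countPartsF Q (suc n) m (suc fuel) ≡
    sum< (m ⊓ suc n) (λ i → countPartsF (λ l → Q (suc i ∷ l)) (n ∸ i) (suc i) fuel)
  countPartsF-suc Q n m fuel = begin
    count Q (concatMap withLargest (map suc (upTo (m ⊓ suc n))))
      ≡⟨ cong (λ xs → count Q (concatMap withLargest xs)) (map-applyUpTo (λ i → i) suc (m ⊓ suc n)) ⟩
    count Q (concatMap withLargest (applyUpTo suc (m ⊓ suc n)))
      ≡⟨ count-concatMap Q withLargest suc (m ⊓ suc n) ⟩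
    sum< (m ⊓ suc n) (λ i → count Q (withLargest (suc i)))
      ≡⟨ sum<-cong (m ⊓ suc n) (λ i _ → count-map Q (suc i ∷_) (partsF (n ∸ i) (suc i) fuel)) ⟩
    sum< (m ⊓ suc n) (λ i → countPartsF (λ l → Q (suc i ∷ l)) (n ∸ i) (suc i) fuel) ∎
    where
    withLargest : ℕ → List (List ℕ)
    withLargest p = map (p ∷_) (partsF (suc n ∸ p) p fuel)

  countPartsF-fuel : ∀ Q n m f f′ → n ≤ f → n ≤ f′ → countPartsF Q n m f ≡ countPartsF Q n m f′
  countPartsF-fuel Q zero    m f       f′       _         _          = refl
  countPartsF-fuel Q (suc n) m (suc f) (suc f′) (s≤s n≤f) (s≤s n≤f′) = begin
    countPartsF Q (suc n) m (suc f)
      ≡⟨ countPartsF-suc Q n m f ⟩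
    sum< (m ⊓ suc n) (λ i → countPartsF (λ l → Q (suc i ∷ l)) (n ∸ i) (suc i) f)
      ≡⟨ sum<-cong (m ⊓ suc n) (λ i _ → countPartsF-fuel _ (n ∸ i) (suc i) f f′
           (ℕ.≤-trans (ℕ.m∸n≤m n i) n≤f) (ℕ.≤-trans (ℕ.m∸n≤m n i) n≤f′)) ⟩
    sum< (m ⊓ suc n) (λ i → countPartsF (λ l → Q (suc i ∷ l)) (n ∸ i) (suc i) f′)
      ≡⟨ countPartsF-suc Q n m f′ ⟨
    countPartsF Q (suc n) m (suc f′) ∎

  countPartsF-cong : ∀ fuel n m {Q Q′} → (∀ l → IsPartition n m l → Q l ≡ Q′ l) →
                     countPartsF Q n m fuel ≡ countPartsF Q′ n m fuel
  countPartsF-cong fuel       zero    m Q≡Q′ = cong 𝟙 (Q≡Q′ [] nil)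
  countPartsF-cong zero       (suc n) m Q≡Q′ = refl
  countPartsF-cong (suc fuel) (suc n) m {Q} {Q′} Q≡Q′ = begin
    countPartsF Q (suc n) m (suc fuel)
      ≡⟨ countPartsF-suc Q n m fuel ⟩
    sum< (m ⊓ suc n) (λ i → countPartsF (λ l → Q (suc i ∷ l)) (n ∸ i) (suc i) fuel)
      ≡⟨ sum<-cong (m ⊓ suc n) (λ i i<m⊓1+n →
           countPartsF-cong fuel (n ∸ i) (suc i) (λ l l-part → Q≡Q′ (suc i ∷ l) (extend i<m⊓1+n l-part))) ⟩
    sum< (m ⊓ suc n) (λ i → countPartsF (λ l → Q′ (suc i ∷ l)) (n ∸ i) (suc i) fuel)
      ≡⟨ countPartsF-suc Q′ n m fuel ⟨
    countPartsF Q′ (suc n) m (suc fuel) ∎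
    where
    extend : ∀ {i l} → i < m ⊓ suc n → IsPartition (n ∸ i) (suc i) l → IsPartition (suc n) m (suc i ∷ l)
    extend {i} {l} i<m⊓1+n l-part =
      subst (λ z → IsPartition z m (suc i ∷ l))
            (cong suc (ℕ.m+[n∸m]≡n (ℕ.≤-pred (ℕ.≤-trans i<m⊓1+n (ℕ.m⊓n≤n m (suc n))))))
            (cons (ℕ.≤-trans i<m⊓1+n (ℕ.m⊓n≤m m (suc n))) l-part)

  countParts-cong : ∀ n m {Q Q′} → (∀ l → IsPartition n m l → Q l ≡ Q′ l) →
                    countParts Q n m ≡ countParts Q′ n m
  countParts-cong n m = countPartsF-cong n n m

  countParts-cong′ : ∀ n m {Q Q′ : Pred} → (∀ l → Q l ≡ Q′ l) → countParts Q n m ≡ countParts Q′ n m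
  countParts-cong′ n m Q≡Q′ = countParts-cong n m (λ l _ → Q≡Q′ l)

  countParts-false : ∀ n m → countParts (λ _ → false) n m ≡ 0
  countParts-false n m = count-false (partsF n m n)

  countParts-splitLargest : ∀ (Q : Pred) N m → suc m ≤ N →
    countParts Q N (suc m) ≡ countParts Q N m + countParts (λ l → Q (suc m ∷ l)) (N ∸ suc m) (suc m)
  countParts-splitLargest Q (suc n) m (s≤s m≤n) = begin
    countPartsF Q (suc n) (suc m) (suc n)
      ≡⟨ countPartsF-suc Q n (suc m) n ⟩
    sum< (suc m ⊓ suc n) g
      ≡⟨ cong (λ z → sum< (suc z) g) (ℕ.m≤n⇒m⊓n≡m m≤n) ⟩
    sum< (suc m) g
      ≡⟨ sum<-suc m g ⟩
    sum< m g + g m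
      ≡⟨ cong₂ _+_ (sym (cong (λ z → sum< z g) (ℕ.m≤n⇒m⊓n≡m (ℕ.m≤n⇒m≤1+n m≤n))))
                 (countPartsF-fuel _ (n ∸ m) (suc m) n (n ∸ m) (ℕ.m∸n≤m n m) ℕ.≤-refl) ⟩
    sum< (m ⊓ suc n) g + countParts (λ l → Q (suc m ∷ l)) (n ∸ m) (suc m)
      ≡⟨ cong (_+ countParts (λ l → Q (suc m ∷ l)) (n ∸ m) (suc m)) (countPartsF-suc Q n m n) ⟨
    countParts Q (suc n) m + countParts (λ l → Q (suc m ∷ l)) (n ∸ m) (suc m) ∎
    where
    g : ℕ → ℕ
    g i = countPartsF (λ l → Q (suc i ∷ l)) (n ∸ i) (suc i) n

  countParts-boundSuc : ∀ (Q : Pred) n m → n ≤ m → countParts Q n (suc m) ≡ countParts Q n m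
  countParts-boundSuc Q zero    m _      = refl
  countParts-boundSuc Q (suc n) m 1+n≤m = begin
    countPartsF Q (suc n) (suc m) (suc n)     ≡⟨ countPartsF-suc Q n (suc m) n ⟩
    sum< (suc m ⊓ suc n) g                    ≡⟨ cong (λ z → sum< z g) (ℕ.m≥n⇒m⊓n≡n (ℕ.m≤n⇒m≤1+n 1+n≤m)) ⟩
    sum< (suc n) g                            ≡⟨ cong (λ z → sum< z g) (ℕ.m≥n⇒m⊓n≡n 1+n≤m) ⟨
    sum< (m ⊓ suc n) g                        ≡⟨ countPartsF-suc Q n m n ⟨
    countPartsF Q (suc n) m (suc n)           ∎
    where
    g : ℕ → ℕ
    g i = countPartsF (λ l → Q (suc i ∷ l)) (n ∸ i) (suc i) n

  countParts-unbounded : ∀ (Q : Pred) n m → n ≤ m → countParts Q n m ≡ countParts Q n n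
  countParts-unbounded Q n m n≤m with ℕ.m≤n⇒m<n∨m≡n n≤m
  ... | inj₂ refl = refl
  countParts-unbounded Q n (suc m) _ | inj₁ (s≤s n≤m) =
    trans (countParts-boundSuc Q n m n≤m) (countParts-unbounded Q n m n≤m)

  -- Three equal rows

  hasTriple : ℕ → List ℕ → Bool
  hasTriple x l = 3 ≤ᵇ count (λ y → y ≡ᵇ x) l

  tripleFreeAbove : ℕ → List ℕ → Bool
  tripleFreeAbove M []      = true
  tripleFreeAbove M (x ∷ l) = ((x ≤ᵇ M) ∨ not (hasTriple x (x ∷ l))) ∧ tripleFreeAbove M l

  insertTriple : ℕ → List ℕ → List ℕ
  insertTriple M []      = M ∷ M ∷ M ∷ []
  insertTriple M (x ∷ l) = if M <ᵇ x then x ∷ insertTriple M l else M ∷ M ∷ M ∷ x ∷ l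

  count-insertTriple : ∀ (p : ℕ → Bool) M l →
    count p (insertTriple M l) ≡ (if p M then 3 else 0) + count p l
  count-insertTriple p M [] with p M
  ... | true  = refl
  ... | false = refl
  count-insertTriple p M (x ∷ l) with M <ᵇ x
  ... | false with p M
  ...   | true  = refl
  ...   | false = refl
  count-insertTriple p M (x ∷ l) | true with p x
  ... | true  = trans (cong suc (count-insertTriple p M l)) (sym (ℕ.+-suc _ _))
  ... | false = count-insertTriple p M l

  tripleFreeAbove-insertTriple : ∀ M l → tripleFreeAbove M (insertTriple M l) ≡ tripleFreeAbove M l
  tripleFreeAbove-insertTriple M [] rewrite ≤⇒≤ᵇ≡true (ℕ.≤-refl {M}) = refl
  tripleFreeAbove-insertTriple M (x ∷ l) with M <ᵇ x in M<ᵇx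
  ... | false rewrite ≤⇒≤ᵇ≡true (ℕ.≤-refl {M}) = refl
  ... | true  = cong₂ _∧_ (cong (λ z → (x ≤ᵇ M) ∨ not (3 ≤ᵇ z)) same-count) (tripleFreeAbove-insertTriple M l)
    where
    M≢x : (M ≡ᵇ x) ≡ false
    M≢x = ≢⇒≡ᵇ≡false (λ M≡x → ℕ.<-irrefl M≡x (ℕ.<ᵇ⇒< M x (subst T (sym M<ᵇx) _)))
    same-count : count (λ y → y ≡ᵇ x) (x ∷ insertTriple M l) ≡ count (λ y → y ≡ᵇ x) (x ∷ l)
    same-count rewrite ≡ᵇ-refl x | count-insertTriple (λ y → y ≡ᵇ x) M l | M≢x = refl

  tripleFreeAbove-pred : ∀ M l → tripleFreeAbove M l ≡ not (hasTriple (suc M) l) ∧ tripleFreeAbove (suc M) l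
  tripleFreeAbove-pred M [] = refl
  tripleFreeAbove-pred M (x ∷ l) with x ℕ.≟ suc M
  ... | yes refl
    rewrite >⇒≤ᵇ≡false (ℕ.n<1+n M) | ≤⇒≤ᵇ≡true (ℕ.≤-refl {suc M}) | ≡ᵇ-refl (suc M)
          | tripleFreeAbove-pred M l =
    absorb (count (λ y → y ≡ᵇ suc M) l) (tripleFreeAbove (suc M) l)
    where
    absorb : ∀ c b → (not (3 ≤ᵇ suc c) ∧ (not (3 ≤ᵇ c) ∧ b)) ≡ (not (3 ≤ᵇ suc c) ∧ b)
    absorb zero          b = refl
    absorb (suc zero)    b = refl
    absorb (suc (suc c)) b = refl
  ... | no x≢1+M rewrite ≢⇒≡ᵇ≡false x≢1+M | tripleFreeAbove-pred M l =
    swap {t = count (λ y → y ≡ᵇ suc M) l} {r = tripleFreeAbove (suc M) l}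
         (cong (λ b → b ∨ not (hasTriple x (x ∷ l))) same-test)
    where
    same-test : (x ≤ᵇ M) ≡ (x ≤ᵇ suc M)
    same-test with ℕ.≤-<-connex x M
    ... | inj₁ x≤M = trans (≤⇒≤ᵇ≡true x≤M) (sym (≤⇒≤ᵇ≡true (ℕ.m≤n⇒m≤1+n x≤M)))
    ... | inj₂ M<x = trans (>⇒≤ᵇ≡false M<x) (sym (>⇒≤ᵇ≡false (ℕ.≤∧≢⇒< M<x (λ 1+M≡x → x≢1+M (sym 1+M≡x)))))
    swap : ∀ {a a′ t r} → a ≡ a′ → (a ∧ (not (3 ≤ᵇ t) ∧ r)) ≡ (not (3 ≤ᵇ t) ∧ (a′ ∧ r))
    swap {a} {t = t} refl with 3 ≤ᵇ t | a
    ... | true  | true  = refl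
    ... | true  | false = refl
    ... | false | true  = refl
    ... | false | false = refl

  module ArmPeriodicCount
    (p : ℕ × ℕ → Bool)
    (periodic : ∀ a L → p (3 + a , L) ≡ p (a , L))
    (δp : ℕ → ℕ)
    (three-arms : ∀ a L → 𝟙 (p (2 + a , L)) + (𝟙 (p (1 + a , L)) + 𝟙 (p (a , L))) ≡ δp L)
    where

    row : ℕ → List ℕ → List (ℕ × ℕ)
    row r above = map (λ c → count (λ x → c ≤ᵇ x) above , r ∸ c) (map suc (upTo r))

    count-row : ∀ r above →
      count p (row r above) ≡ sum< r (λ i → 𝟙 (p (count (λ x → suc i ≤ᵇ x) above , r ∸ suc i)))
    count-row r above = trans (count-map p _ (map suc (upTo r)))
      (trans (count-map _ suc (upTo r)) (count-applyUpTo _ (λ i → i) r))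

    count-row-insertTriple : ∀ M x l → count p (row x (insertTriple M l)) ≡ count p (row x l)
    count-row-insertTriple M x l =
      trans (count-row x (insertTriple M l)) (trans (sum<-cong x same-box) (sym (count-row x l)))
      where
      same-box : ∀ i → i < x → 𝟙 (p (count (λ y → suc i ≤ᵇ y) (insertTriple M l) , x ∸ suc i))
                              ≡ 𝟙 (p (count (λ y → suc i ≤ᵇ y) l , x ∸ suc i))
      same-box i _ rewrite count-insertTriple (λ y → suc i ≤ᵇ y) M l with suc i ≤ᵇ M
      ... | true  = cong 𝟙 (periodic _ _)
      ... | false = refl

    count-threeRows : ∀ M L →
      count p (armLegs (M ∷ M ∷ M ∷ L)) ≡ sum< M (λ i → δp (M ∸ suc i)) + count p (armLegs L)
    count-threeRows M L = begin
      count p (row M (M ∷ M ∷ L) ++ row M (M ∷ L) ++ row M L ++ armLegs L)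
        ≡⟨ trans (count-++ p (row M (M ∷ M ∷ L)) _) (cong (count p (row M (M ∷ M ∷ L)) +_)
             (trans (count-++ p (row M (M ∷ L)) _) (cong (count p (row M (M ∷ L)) +_) (count-++ p (row M L) _)))) ⟩
      count p (row M (M ∷ M ∷ L)) + (count p (row M (M ∷ L)) + (count p (row M L) + rest))
        ≡⟨ cong₂ _+_ (count-row M (M ∷ M ∷ L)) (cong₂ _+_ (count-row M (M ∷ L)) (cong (_+ rest) (count-row M L))) ⟩
      sum< M top + (sum< M middle + (sum< M bottom + rest))
        ≡⟨ cong (sum< M top +_) (sym (ℕ.+-assoc (sum< M middle) _ rest)) ⟩
      sum< M top + ((sum< M middle + sum< M bottom) + rest)
        ≡⟨ sym (ℕ.+-assoc (sum< M top) _ rest) ⟩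
      (sum< M top + (sum< M middle + sum< M bottom)) + rest
        ≡⟨ cong (_+ rest) (trans (cong (sum< M top +_) (sym (sum<-distrib-+ M middle bottom)))
                                 (sym (sum<-distrib-+ M top _))) ⟩
      sum< M (λ i → top i + (middle i + bottom i)) + rest
        ≡⟨ cong (_+ rest) (sum<-cong M column) ⟩
      sum< M (λ i → δp (M ∸ suc i)) + rest ∎
      where
      rest = count p (armLegs L)
      top middle bottom : ℕ → ℕ
      top    i = 𝟙 (p (count (λ x → suc i ≤ᵇ x) (M ∷ M ∷ L) , M ∸ suc i))
      middle i = 𝟙 (p (count (λ x → suc i ≤ᵇ x) (M ∷ L) , M ∸ suc i))
      bottom i = 𝟙 (p (count (λ x → suc i ≤ᵇ x) L , M ∸ suc i))
      column : ∀ i → i < M → top i + (middle i + bottom i) ≡ δp (M ∸ suc i)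
      column i i<M rewrite ≤⇒≤ᵇ≡true i<M = three-arms _ _

    count-armLegs-insertTriple : ∀ M l →
      count p (armLegs (insertTriple M l)) ≡ sum< M (λ i → δp (M ∸ suc i)) + count p (armLegs l)
    count-armLegs-insertTriple M []      = count-threeRows M []
    count-armLegs-insertTriple M (x ∷ l) with M <ᵇ x
    ... | false = count-threeRows M (x ∷ l)
    ... | true  = begin
      count p (row x (insertTriple M l) ++ armLegs (insertTriple M l))
        ≡⟨ count-++ p (row x (insertTriple M l)) _ ⟩
      count p (row x (insertTriple M l)) + count p (armLegs (insertTriple M l))
        ≡⟨ cong₂ _+_ (count-row-insertTriple M x l) (count-armLegs-insertTriple M l) ⟩
      count p (row x l) + (added + count p (armLegs l))
        ≡⟨ x∙yz≈y∙xz (count p (row x l)) added _ ⟩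
      added + (count p (row x l) + count p (armLegs l))
        ≡⟨ cong (added +_) (count-++ p (row x l) (armLegs l)) ⟨
      added + count p (armLegs (x ∷ l)) ∎
      where
      added = sum< M (λ i → δp (M ∸ suc i))

  -- The two weights

  cond3-periodic : ∀ a L → cond3 (3 + a , L) ≡ cond3 (a , L)
  cond3-periodic a L =
    cong (λ z → z ≡ᵇ (L % 3)) (trans (cong (_% 3) (ℕ.+-comm 3 (suc a))) ([m+n]%n≡m%n (suc a) 3))

  cond3-threeArms : ∀ a L → 𝟙 (cond3 (2 + a , L)) + (𝟙 (cond3 (1 + a , L)) + 𝟙 (cond3 (a , L))) ≡ 1
  cond3-threeArms a L = trans
    (cong₂ _+_ (cong (λ z → 𝟙 (z ≡ᵇ (L % 3))) (%-distribˡ-+ 3 a 3))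
      (cong₂ _+_ (cong (λ z → 𝟙 (z ≡ᵇ (L % 3))) (%-distribˡ-+ 2 a 3))
                 (cong (λ z → 𝟙 (z ≡ᵇ (L % 3))) (%-distribˡ-+ 1 a 3))))
    (residues (a % 3) (L % 3) (m%n<n a 3) (m%n<n L 3))
    where
    residues : ∀ r s → r < 3 → s < 3 →
      𝟙 ((3 % 3 + r) % 3 ≡ᵇ s) + (𝟙 ((2 % 3 + r) % 3 ≡ᵇ s) + 𝟙 ((1 % 3 + r) % 3 ≡ᵇ s)) ≡ 1
    residues 0 0 _ _ = refl
    residues 0 1 _ _ = refl
    residues 0 2 _ _ = refl
    residues 1 0 _ _ = refl
    residues 1 1 _ _ = refl
    residues 1 2 _ _ = refl
    residues 2 0 _ _ = refl
    residues 2 1 _ _ = refl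
    residues 2 2 _ _ = refl
    residues (suc (suc (suc r))) _ (s≤s (s≤s (s≤s ()))) _
    residues 0 (suc (suc (suc s))) _ (s≤s (s≤s (s≤s ())))
    residues 1 (suc (suc (suc s))) _ (s≤s (s≤s (s≤s ())))
    residues 2 (suc (suc (suc s))) _ (s≤s (s≤s (s≤s ())))

  cond3⁺ : ℕ × ℕ → Bool
  cond3⁺ (a , L) = (0 <ᵇ L) ∧ cond3 (a , L)

  wtZ3≡count-cond3⁺ : ∀ l → wtZ3 l ≡ count cond3⁺ (armLegs l)
  wtZ3≡count-cond3⁺ l = count-cong (armLegs l) (λ { (a , L) → refl })

  cond3⁺-periodic : ∀ a L → cond3⁺ (3 + a , L) ≡ cond3⁺ (a , L)
  cond3⁺-periodic a L = cong ((0 <ᵇ L) ∧_) (cond3-periodic a L)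

  cond3⁺-threeArms : ∀ a L →
    𝟙 (cond3⁺ (2 + a , L)) + (𝟙 (cond3⁺ (1 + a , L)) + 𝟙 (cond3⁺ (a , L))) ≡ 𝟙 (0 <ᵇ L)
  cond3⁺-threeArms a L with 0 <ᵇ L
  ... | true  = cond3-threeArms a L
  ... | false = refl

  sum<-positiveLegs : ∀ M → sum< M (λ i → 𝟙 (0 <ᵇ (M ∸ suc i))) ≡ M ∸ 1
  sum<-positiveLegs zero    = refl
  sum<-positiveLegs (suc M) = begin
    sum< (suc M) (λ i → 𝟙 (0 <ᵇ (suc M ∸ suc i)))                ≡⟨ sum<-suc M _ ⟩
    sum< M (λ i → 𝟙 (0 <ᵇ (M ∸ i))) + 𝟙 (0 <ᵇ (M ∸ M))           ≡⟨ cong₂ _+_ (sum<-cong M positive) (cong (λ z → 𝟙 (0 <ᵇ z)) (ℕ.n∸n≡0 M)) ⟩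
    sum< M (λ _ → 1) + 0                                         ≡⟨ ℕ.+-identityʳ _ ⟩
    sum< M (λ _ → 1)                                             ≡⟨ sum<-const1 M ⟩
    M                                                            ∎
    where
    positive : ∀ i → i < M → 𝟙 (0 <ᵇ (M ∸ i)) ≡ 1
    positive i i<M rewrite T⇒≡true (ℕ.<⇒<ᵇ (ℕ.m<n⇒0<n∸m i<M)) = refl

  wtZ3~-insertTriple : ∀ M l → wtZ3~ (insertTriple M l) ≡ M + wtZ3~ l
  wtZ3~-insertTriple M l =
    trans (ArmPeriodicCount.count-armLegs-insertTriple cond3 cond3-periodic (λ _ → 1) cond3-threeArms M l)
          (cong (_+ wtZ3~ l) (sum<-const1 M))

  wtZ3-insertTriple : ∀ M l → wtZ3 (insertTriple M l) ≡ (M ∸ 1) + wtZ3 l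
  wtZ3-insertTriple M l = begin
    wtZ3 (insertTriple M l)
      ≡⟨ wtZ3≡count-cond3⁺ (insertTriple M l) ⟩
    count cond3⁺ (armLegs (insertTriple M l))
      ≡⟨ ArmPeriodicCount.count-armLegs-insertTriple cond3⁺ cond3⁺-periodic (λ L → 𝟙 (0 <ᵇ L)) cond3⁺-threeArms M l ⟩
    sum< M (λ i → 𝟙 (0 <ᵇ (M ∸ suc i))) + count cond3⁺ (armLegs l)
      ≡⟨ cong₂ _+_ (sum<-positiveLegs M) (sym (wtZ3≡count-cond3⁺ l)) ⟩
    (M ∸ 1) + wtZ3 l ∎

  count-absent : ∀ {n m l} M → m < M → IsPartition n m l → count (λ y → y ≡ᵇ M) l ≡ 0
  count-absent M m<M nil = refl
  count-absent M m<M (cons {i = i} 1+i≤m p)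
    rewrite ≢⇒≡ᵇ≡false {suc i} {M} (λ 1+i≡M → ℕ.<-irrefl 1+i≡M (ℕ.≤-<-trans 1+i≤m m<M)) =
    count-absent M (ℕ.≤-<-trans 1+i≤m m<M) p

  count*≤size : ∀ {n m l} M → IsPartition n m l → count (λ y → y ≡ᵇ M) l * M ≤ n
  count*≤size M nil = z≤n
  count*≤size M (cons {n} {i = i} 1+i≤m p) with suc i ℕ.≟ M
  ... | yes refl rewrite ≡ᵇ-refl (suc i) = ℕ.+-monoʳ-≤ (suc i) (count*≤size (suc i) p)
  ... | no 1+i≢M rewrite ≢⇒≡ᵇ≡false 1+i≢M = ℕ.≤-trans (count*≤size M p) (ℕ.m≤n+m n (suc i))

  hasTriple-small : ∀ {j m l} M → j < 3 * M → IsPartition j m l → hasTriple M l ≡ false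
  hasTriple-small {l = l} M j<3M p = ¬T⇒≡false (λ triple → ℕ.<⇒≱ j<3M
    (ℕ.≤-trans (ℕ.*-monoˡ-≤ M (ℕ.≤ᵇ⇒≤ 3 (count (λ y → y ≡ᵇ M) l) triple)) (count*≤size M p)))

  insertTriple-bounded : ∀ {n l} M → IsPartition n M l → insertTriple M l ≡ M ∷ M ∷ M ∷ l
  insertTriple-bounded M nil = refl
  insertTriple-bounded M (cons {i = i} 1+i≤M p)
    rewrite ¬T⇒≡false {M <ᵇ suc i} (λ t → ℕ.<⇒≱ (ℕ.<ᵇ⇒< M (suc i) t) 1+i≤M) = refl

  tripleFreeAbove-bounded : ∀ {n m l} N → m ≤ N → IsPartition n m l → tripleFreeAbove N l ≡ true
  tripleFreeAbove-bounded N m≤N nil = refl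
  tripleFreeAbove-bounded N m≤N (cons 1+i≤m p) rewrite ≤⇒≤ᵇ≡true (ℕ.≤-trans 1+i≤m m≤N) =
    tripleFreeAbove-bounded N (ℕ.≤-trans 1+i≤m m≤N) p

  -- Removing three equal rows

  +3*≡+++ : ∀ a M → a + 3 * M ≡ a + M + M + M
  +3*≡+++ = solve-∀

  module TripleRemoval (M′ : ℕ) where

    M : ℕ
    M = suc M′

    withTriple : Pred → Pred
    withTriple Q l = hasTriple M l ∧ Q l

    afterInsert : Pred → Pred
    afterInsert Q l = Q (insertTriple M l)

    splitOffM : ∀ (Q : Pred) a → countParts Q (a + M) M ≡ countParts Q (a + M) M′ + countParts (λ l → Q (M ∷ l)) a M
    splitOffM Q a = trans (countParts-splitLargest Q (a + M) M′ (ℕ.m≤n+m M a))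
      (cong (λ z → countParts Q (a + M) M′ + countParts (λ l → Q (M ∷ l)) z M) (ℕ.m+n∸n≡m a M))

    noTriple-belowM : ∀ (Q : Pred) N (pre : List ℕ) →
      (∀ l → count (λ y → y ≡ᵇ M) l ≡ 0 → hasTriple M (pre ++ l) ≡ false) →
      countParts (λ l → withTriple Q (pre ++ l)) N M′ ≡ 0
    noTriple-belowM Q N pre fewM = trans
      (countParts-cong N M′ (λ l p → cong (_∧ Q (pre ++ l)) (fewM l (count-absent M (ℕ.n<1+n M′) p))))
      (countParts-false N M′)

    countParts-withTriple-small : ∀ j m (Q : Pred) → j < 3 * M → countParts (withTriple Q) j m ≡ 0
    countParts-withTriple-small j m Q j<3M =
      trans (countParts-cong j m (λ l p → cong (_∧ Q l) (hasTriple-small M j<3M p))) (countParts-false j m)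

    removeTriple-boundM : ∀ n (Q : Pred) →
      countParts (withTriple Q) (n + 3 * M) M ≡ countParts (afterInsert Q) n M
    removeTriple-boundM n Q = begin
      countParts (withTriple Q) (n + 3 * M) M
        ≡⟨ cong (λ z → countParts (withTriple Q) z M) (+3*≡+++ n M) ⟩
      countParts (withTriple Q) (n + M + M + M) M
        ≡⟨ splitOffM (withTriple Q) (n + M + M) ⟩
      countParts (withTriple Q) (n + M + M + M) M′ + countParts (λ l → withTriple Q (M ∷ l)) (n + M + M) M
        ≡⟨ cong₂ _+_ (noTriple-belowM Q (n + M + M + M) [] (λ l none → cong (3 ≤ᵇ_) none))
                     (splitOffM (λ l → withTriple Q (M ∷ l)) (n + M)) ⟩
      0 + (countParts (λ l → withTriple Q (M ∷ l)) (n + M + M) M′ + countParts (λ l → withTriple Q (M ∷ M ∷ l)) (n + M) M)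
        ≡⟨ cong (_+ countParts (λ l → withTriple Q (M ∷ M ∷ l)) (n + M) M)
                (noTriple-belowM Q (n + M + M) (M ∷ []) oneM) ⟩
      0 + countParts (λ l → withTriple Q (M ∷ M ∷ l)) (n + M) M
        ≡⟨ splitOffM (λ l → withTriple Q (M ∷ M ∷ l)) n ⟩
      countParts (λ l → withTriple Q (M ∷ M ∷ l)) (n + M) M′ + countParts (λ l → withTriple Q (M ∷ M ∷ M ∷ l)) n M
        ≡⟨ cong (_+ countParts (λ l → withTriple Q (M ∷ M ∷ M ∷ l)) n M)
                (noTriple-belowM Q (n + M) (M ∷ M ∷ []) twoM) ⟩
      countParts (λ l → withTriple Q (M ∷ M ∷ M ∷ l)) n M
        ≡⟨ countParts-cong n M (λ l p → trans (cong (_∧ Q (M ∷ M ∷ M ∷ l)) (threeM l))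
                                              (cong Q (sym (insertTriple-bounded M p)))) ⟩
      countParts (afterInsert Q) n M ∎
      where
      oneM : ∀ l → count (λ y → y ≡ᵇ M) l ≡ 0 → hasTriple M (M ∷ l) ≡ false
      oneM l none rewrite ≡ᵇ-refl M | none = refl
      twoM : ∀ l → count (λ y → y ≡ᵇ M) l ≡ 0 → hasTriple M (M ∷ M ∷ l) ≡ false
      twoM l none rewrite ≡ᵇ-refl M | none = refl
      threeM : ∀ l → hasTriple M (M ∷ M ∷ M ∷ l) ≡ true
      threeM l rewrite ≡ᵇ-refl M = refl

    hasTriple-cons : ∀ x l → M < x → hasTriple M (x ∷ l) ≡ hasTriple M l
    hasTriple-cons x l M<x rewrite ≢⇒≡ᵇ≡false {x} {M} (λ x≡M → ℕ.<-irrefl (sym x≡M) M<x) = refl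

    insertTriple-cons : ∀ x l → M < x → insertTriple M (x ∷ l) ≡ x ∷ insertTriple M l
    insertTriple-cons x l M<x rewrite T⇒≡true (ℕ.<⇒<ᵇ M<x) = refl

    withTriple-boundSuc : ∀ n m (Q : Pred) → M ≤ m → n ≤ m →
      countParts (withTriple Q) (n + 3 * M) (suc m) ≡ countParts (withTriple Q) (n + 3 * M) m
    withTriple-boundSuc n m Q M≤m n≤m with suc m ℕ.≤? n + 3 * M
    ... | no 1+m≰size = countParts-boundSuc (withTriple Q) (n + 3 * M) m (ℕ.≤-pred (ℕ.≰⇒> 1+m≰size))
    ... | yes 1+m≤size = begin
      countParts (withTriple Q) (n + 3 * M) (suc m)
        ≡⟨ countParts-splitLargest (withTriple Q) (n + 3 * M) m 1+m≤size ⟩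
      countParts (withTriple Q) (n + 3 * M) m + countParts (λ l → withTriple Q (suc m ∷ l)) rest (suc m)
        ≡⟨ cong (countParts (withTriple Q) (n + 3 * M) m +_) (begin
             countParts (λ l → withTriple Q (suc m ∷ l)) rest (suc m)
               ≡⟨ countParts-cong′ rest (suc m) (λ l → cong (_∧ Q (suc m ∷ l)) (hasTriple-cons (suc m) l (s≤s M≤m))) ⟩
             countParts (withTriple (λ l → Q (suc m ∷ l))) rest (suc m)
               ≡⟨ countParts-withTriple-small rest (suc m) _ (ℕ.m<n+o⇒m∸n<o (n + 3 * M) (suc m) (ℕ.+-monoˡ-< (3 * M) (s≤s n≤m))) ⟩
             0 ∎) ⟩
      countParts (withTriple Q) (n + 3 * M) m + 0
        ≡⟨ ℕ.+-identityʳ _ ⟩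
      countParts (withTriple Q) (n + 3 * M) m ∎
      where
      rest = n + 3 * M ∸ suc m

    removeTriple : ∀ d fuel n → n ≤ fuel → ∀ (Q : Pred) →
      countParts (withTriple Q) (n + 3 * M) (d + M) ≡ countParts (afterInsert Q) n (d + M)
    removeTriple zero    fuel n _ Q = removeTriple-boundM n Q
    removeTriple (suc d) fuel n n≤fuel Q with suc d + M ℕ.≤? n
    removeTriple (suc d) fuel n n≤fuel Q | no x≰n =
      trans (withTriple-boundSuc n (d + M) Q (ℕ.m≤n+m M d) (ℕ.≤-pred (ℕ.≰⇒> x≰n)))
            (trans (removeTriple d fuel n n≤fuel Q)
                   (sym (countParts-boundSuc (afterInsert Q) n (d + M) (ℕ.≤-pred (ℕ.≰⇒> x≰n)))))
    removeTriple (suc d) (suc fuel) n n≤fuel Q | yes x≤n = begin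
      countParts (withTriple Q) (n + 3 * M) x
        ≡⟨ countParts-splitLargest (withTriple Q) (n + 3 * M) (d + M) (ℕ.≤-trans x≤n (ℕ.m≤m+n n (3 * M))) ⟩
      countParts (withTriple Q) (n + 3 * M) (d + M) + countParts (λ l → withTriple Q (x ∷ l)) (n + 3 * M ∸ x) x
        ≡⟨ cong₂ _+_ (removeTriple d (suc fuel) n n≤fuel Q) (begin
             countParts (λ l → withTriple Q (x ∷ l)) (n + 3 * M ∸ x) x
               ≡⟨ cong (λ z → countParts (λ l → withTriple Q (x ∷ l)) z x) (ℕ.+-∸-comm (3 * M) x≤n) ⟩
             countParts (λ l → withTriple Q (x ∷ l)) (n ∸ x + 3 * M) x
               ≡⟨ countParts-cong′ (n ∸ x + 3 * M) x (λ l → cong (_∧ Q (x ∷ l)) (hasTriple-cons x l M<x)) ⟩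
             countParts (withTriple (λ l → Q (x ∷ l))) (n ∸ x + 3 * M) x
               ≡⟨ removeTriple (suc d) fuel (n ∸ x) n∸x≤fuel (λ l → Q (x ∷ l)) ⟩
             countParts (afterInsert (λ l → Q (x ∷ l))) (n ∸ x) x
               ≡⟨ countParts-cong′ (n ∸ x) x (λ l → cong Q (sym (insertTriple-cons x l M<x))) ⟩
             countParts (λ l → afterInsert Q (x ∷ l)) (n ∸ x) x ∎) ⟩
      countParts (afterInsert Q) n (d + M) + countParts (λ l → afterInsert Q (x ∷ l)) (n ∸ x) x
        ≡⟨ countParts-splitLargest (afterInsert Q) n (d + M) x≤n ⟨
      countParts (afterInsert Q) n x ∎
      where
      x = suc d + M
      M<x : M < x
      M<x = s≤s (ℕ.m≤n+m M d)
      n∸x≤fuel : n ∸ x ≤ fuel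
      n∸x≤fuel = ℕ.≤-trans (ℕ.∸-monoʳ-≤ n (s≤s z≤n)) (ℕ.∸-monoˡ-≤ 1 n≤fuel)
    removeTriple (suc d) zero zero _ Q | yes ()

    countParts-withTriple : ∀ n (Q : Pred) → countParts (withTriple Q) n n ≡
      (if 3 * M ≤ᵇ n then countParts (afterInsert Q) (n ∸ 3 * M) (n ∸ 3 * M) else 0)
    countParts-withTriple n Q with 3 * M ℕ.≤? n
    ... | no 3M≰n rewrite >⇒≤ᵇ≡false (ℕ.≰⇒> 3M≰n) = countParts-withTriple-small n n Q (ℕ.≰⇒> 3M≰n)
    ... | yes 3M≤n rewrite ≤⇒≤ᵇ≡true 3M≤n = begin
      countParts (withTriple Q) n n
        ≡⟨ cong (λ z → countParts (withTriple Q) z z) (ℕ.m∸n+n≡m 3M≤n) ⟨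
      countParts (withTriple Q) (a + 3 * M) (a + 3 * M)
        ≡⟨ cong (countParts (withTriple Q) (a + 3 * M)) (+3*≡+++ a M) ⟩
      countParts (withTriple Q) (a + 3 * M) (a + M + M + M)
        ≡⟨ removeTriple (a + M + M) (a + M + M + M) a a≤a+M+M+M Q ⟩
      countParts (afterInsert Q) a (a + M + M + M)
        ≡⟨ countParts-unbounded (afterInsert Q) a _ a≤a+M+M+M ⟩
      countParts (afterInsert Q) a a ∎
      where
      a = n ∸ 3 * M
      a≤a+M+M+M : a ≤ a + M + M + M
      a≤a+M+M+M = ℕ.≤-trans (ℕ.m≤m+n a M) (ℕ.≤-trans (ℕ.m≤m+n (a + M) M) (ℕ.m≤m+n (a + M + M) M))

  countReduced : (List ℕ → ℕ) → ℕ → ℕ → ℕ → ℕ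
  countReduced w M n k = countParts (λ l → tripleFreeAbove M l ∧ (w l ≡ᵇ k)) n n

  countReduced-large : ∀ w N n k → n ≤ N → countReduced w N n k ≡ count (λ l → w l ≡ᵇ k) (partitions n)
  countReduced-large w N n k n≤N =
    countParts-cong n n (λ l p → cong (_∧ (w l ≡ᵇ k)) (tripleFreeAbove-bounded N n≤N p))

  +≡ᵇ-shift : ∀ d x k → d ≤ k → ((d + x) ≡ᵇ k) ≡ (x ≡ᵇ (k ∸ d))
  +≡ᵇ-shift zero    x k       _         = refl
  +≡ᵇ-shift (suc d) x (suc k) (s≤s d≤k) = +≡ᵇ-shift d x k d≤k

  +≡ᵇ-small : ∀ d x k → k < d → ((d + x) ≡ᵇ k) ≡ false
  +≡ᵇ-small (suc d) x zero    _         = refl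
  +≡ᵇ-small (suc d) x (suc k) (s≤s k<d) = +≡ᵇ-small d x k k<d

  countReduced-shift : ∀ w M d k a →
    countParts (λ l → tripleFreeAbove M l ∧ ((d + w l) ≡ᵇ k)) a a ≡ (if d ≤ᵇ k then countReduced w M a (k ∸ d) else 0)
  countReduced-shift w M d k a with d ℕ.≤? k
  ... | yes d≤k rewrite ≤⇒≤ᵇ≡true d≤k =
    countParts-cong′ a a (λ l → cong (tripleFreeAbove M l ∧_) (+≡ᵇ-shift d (w l) k d≤k))
  ... | no d≰k rewrite >⇒≤ᵇ≡false (ℕ.≰⇒> d≰k) = trans
    (countParts-cong′ a a (λ l → trans (cong (tripleFreeAbove M l ∧_) (+≡ᵇ-small d (w l) k (ℕ.≰⇒> d≰k))) (∧-zeroʳ _)))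
    (countParts-false a a)

  countReduced-suc : ∀ (w : List ℕ → ℕ) (d : ℕ → ℕ) → (∀ M l → w (insertTriple M l) ≡ d M + w l) →
    ∀ m n k → countReduced w (suc m) n k ≡ countReduced w m n k +
      (if (3 * suc m ≤ᵇ n) ∧ (d (suc m) ≤ᵇ k) then countReduced w (suc m) (n ∸ 3 * suc m) (k ∸ d (suc m)) else 0)
  countReduced-suc w d w-insertTriple m n k = begin
    countParts Q n n
      ≡⟨ count-split Q (hasTriple M) (partsF n n n) ⟩
    countParts (λ l → not (hasTriple M l) ∧ Q l) n n + countParts (withTriple Q) n n
      ≡⟨ cong₂ _+_ (countParts-cong′ n n withoutTriple) (countParts-withTriple n Q) ⟩
    countReduced w m n k + (if 3 * M ≤ᵇ n then countParts (afterInsert Q) a a else 0)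
      ≡⟨ cong (countReduced w m n k +_) (inserted (3 * M ≤ᵇ n)) ⟩
    countReduced w m n k + (if (3 * M ≤ᵇ n) ∧ (d M ≤ᵇ k) then countReduced w M a (k ∸ d M) else 0) ∎
    where
    open TripleRemoval m
    a = n ∸ 3 * M
    Q : Pred
    Q l = tripleFreeAbove M l ∧ (w l ≡ᵇ k)
    withoutTriple : ∀ l → (not (hasTriple M l) ∧ Q l) ≡ (tripleFreeAbove m l ∧ (w l ≡ᵇ k))
    withoutTriple l = trans (sym (∧-assoc (not (hasTriple M l)) _ _)) (cong (_∧ (w l ≡ᵇ k)) (sym (tripleFreeAbove-pred m l)))
    inserted : ∀ b → (if b then countParts (afterInsert Q) a a else 0)
                   ≡ (if b ∧ (d M ≤ᵇ k) then countReduced w M a (k ∸ d M) else 0)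
    inserted false = refl
    inserted true  = trans
      (countParts-cong′ a a (λ l → cong₂ _∧_ (tripleFreeAbove-insertTriple M l) (cong (_≡ᵇ k) (w-insertTriple M l))))
      (countReduced-shift w M (d M) k a)

  count≥≤count-largest : ∀ {n r l} c → r ≤ c → IsPartition n r l → count (λ x → c ≤ᵇ x) l ≤ count (λ y → y ≡ᵇ r) l
  count≥≤count-largest c r≤c nil = z≤n
  count≥≤count-largest {r = r} c r≤c (cons {i = j} 1+j≤r p) with c ≤ᵇ suc j in c≤ᵇ1+j
  ... | true
    rewrite T⇒≡true (ℕ.≡⇒≡ᵇ (suc j) r (ℕ.≤-antisym 1+j≤r (ℕ.≤-trans r≤c (ℕ.≤ᵇ⇒≤ c (suc j) (subst T (sym c≤ᵇ1+j) _)))))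
    = s≤s (count≥≤count-largest c r≤c (IsPartition-weaken 1+j≤r p))
  ... | false with suc j ≡ᵇ r
  ...   | true  = ℕ.m≤n⇒m≤1+n (count≥≤count-largest c r≤c (IsPartition-weaken 1+j≤r p))
  ...   | false = count≥≤count-largest c r≤c (IsPartition-weaken 1+j≤r p)

  wtZ3~≡wtZ3-tripleFree : ∀ {n m l} → IsPartition n m l → tripleFreeAbove 0 l ≡ true → wtZ3~ l ≡ wtZ3 l
  wtZ3~≡wtZ3-tripleFree nil _ = refl
  wtZ3~≡wtZ3-tripleFree (cons {i = i} {l = l} _ p) free
    with hasTriple (suc i) (suc i ∷ l) in triple | tripleFreeAbove 0 l in free-l
  wtZ3~≡wtZ3-tripleFree (cons _ p) () | true  | _
  wtZ3~≡wtZ3-tripleFree (cons _ p) () | false | false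
  wtZ3~≡wtZ3-tripleFree (cons {i = i} {l = l} _ p) _ | false | true = begin
    count cond3 (row ++ armLegs l)                     ≡⟨ count-++ cond3 row (armLegs l) ⟩
    count cond3 row + wtZ3~ l                          ≡⟨ cong₂ _+_ same-row (trans (wtZ3~≡wtZ3-tripleFree p free-l) (wtZ3≡count-cond3⁺ l)) ⟩
    count cond3⁺ row + count cond3⁺ (armLegs l)        ≡⟨ count-++ cond3⁺ row (armLegs l) ⟨
    count cond3⁺ (armLegs (suc i ∷ l))                 ≡⟨ wtZ3≡count-cond3⁺ (suc i ∷ l) ⟨
    wtZ3 (suc i ∷ l)                                   ∎
    where
    r = suc i
    row = map (λ c → count (λ x → c ≤ᵇ x) l , r ∸ c) (map suc (upTo r))
    equal-rows≤1 : count (λ y → y ≡ᵇ r) l ≤ 1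
    equal-rows≤1 = fewer (count (λ y → y ≡ᵇ r) l)
      (trans (cong (λ b → 3 ≤ᵇ (if b then suc (count (λ y → y ≡ᵇ r) l) else count (λ y → y ≡ᵇ r) l))
                   (sym (≡ᵇ-refl r))) triple)
      where
      fewer : ∀ c → (3 ≤ᵇ suc c) ≡ false → c ≤ 1
      fewer zero          _ = z≤n
      fewer (suc zero)    _ = s≤s z≤n
      fewer (suc (suc c)) ()
    arm≤1-fails : ∀ a → a ≤ 1 → false ≡ cond3 (a , 0)
    arm≤1-fails zero       _ = refl
    arm≤1-fails (suc zero) _ = refl
    arm≤1-fails (suc (suc a)) (s≤s ())
    same-box : ∀ c → cond3 (count (λ x → c ≤ᵇ x) l , r ∸ c) ≡ cond3⁺ (count (λ x → c ≤ᵇ x) l , r ∸ c)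
    same-box c with r ∸ c in leg
    ... | suc _ = refl
    ... | zero  = sym (arm≤1-fails _ (ℕ.≤-trans (count≥≤count-largest c (ℕ.m∸n≡0⇒m≤n leg) p) equal-rows≤1))
    same-row : count cond3 row ≡ count cond3⁺ row
    same-row = trans (count-map cond3 _ (map suc (upTo r)))
      (trans (count-cong (map suc (upTo r)) same-box) (sym (count-map cond3⁺ _ (map suc (upTo r)))))

  countReduced-wtZ3~≡wtZ3 : ∀ n k → countReduced wtZ3~ 0 n k ≡ countReduced wtZ3 0 n k
  countReduced-wtZ3~≡wtZ3 n k = countParts-cong n n same
    where
    same : ∀ l → IsPartition n n l → (tripleFreeAbove 0 l ∧ (wtZ3~ l ≡ᵇ k)) ≡ (tripleFreeAbove 0 l ∧ (wtZ3 l ≡ᵇ k))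
    same l p with tripleFreeAbove 0 l in free
    ... | false = refl
    ... | true  = cong (_≡ᵇ k) (wtZ3~≡wtZ3-tripleFree p free)

module BivariateSeries where

  open import Data.Bool using (_∧_)
  open import Data.List using (List)
  open import Data.Integer as ℤ using (ℤ; +_)
  import Data.Integer.Properties as ℤ
  open ≡ using (refl; cong; cong₂)

  module T = PowerSeries ℤ.+-*-commutativeRing
  module Q = PowerSeries T.seriesRing

  module Tₛ = CommutativeRing T.seriesRing
  open Tₛ using () renaming (_≈_ to _≈ₜ_; 1# to 1ₜ)
  open CommutativeRing Q.seriesRing hiding (refl) renaming (sym to ≈-sym; trans to ≈-trans)

  sumTo≡∑ : ∀ n f → sumTo n f ≡ T.∑ n f
  sumTo≡∑ zero    f = refl
  sumTo≡∑ (suc n) f = cong (ℤ._+ f (suc n)) (sumTo≡∑ n f)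

  ∑-apply : ∀ n h k → Q.∑ n h k ≡ T.∑ n (λ a → h a k)
  ∑-apply zero    h k = refl
  ∑-apply (suc n) h k = cong (ℤ._+ h (suc n) k) (∑-apply n h k)

  ⊛≈* : ∀ F G → (F ⊛ G) ≈ F * G
  ⊛≈* F G n k = ≡.trans (sumTo≡∑ n _) (≡.sym (≡.trans (∑-apply n _ k)
    (T.∑-cong′ n (λ a → ≡.sym (sumTo≡∑ k _)))))

  one≈1# : one ≈ 1#
  one≈1# zero    zero    = refl
  one≈1# zero    (suc k) = refl
  one≈1# (suc n) k       = refl

  infix 4 _≈[_]_
  _≈[_]_ : PS → ℕ → PS → Set
  F ≈[ N ] G = ∀ a → a ≤ N → F a ≈ₜ G a

  ≈[]-weaken : ∀ {F G N i} → i ≤ N → F ≈[ N ] G → F ≈[ i ] G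
  ≈[]-weaken i≤N F≈G a a≤i = F≈G a (ℕ.≤-trans a≤i i≤N)

  *-cong-≈[] : ∀ {F F′ G G′} N → F ≈[ N ] F′ → G ≈[ N ] G′ → F * G ≈[ N ] F′ * G′
  *-cong-≈[] N = Q.⋆-cong≤ N

  invRows-lookup : ∀ F n j → j ≤ n → lookupD (invRows F n) (n ∸ j) ≡ inv F j
  invRows-lookup F zero    zero z≤n = refl
  invRows-lookup F (suc n) j    j≤1+n with ℕ.m≤n⇒m<n∨m≡n j≤1+n
  ... | inj₂ refl rewrite ℕ.n∸n≡0 (suc n) = refl
  ... | inj₁ (s≤s j≤n) rewrite ℕ.+-∸-assoc 1 j≤n = invRows-lookup F n j j≤n

  inv-suc : ∀ F n k → inv F (suc n) k ≡ ℤ.- T.∑ n (λ a → (F (suc a) T.⋆ inv F (n ∸ a)) k)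
  inv-suc F n k = cong ℤ.-_ (begin
    sumTo (suc n) (λ a → if a ≡ᵇ 0 then + 0 else tmul (F a) (lookupD (invRows F n) (n ∸ (suc n ∸ a))) k)
      ≡⟨ sumTo≡∑ (suc n) _ ⟩
    T.∑ (suc n) (λ a → if a ≡ᵇ 0 then + 0 else tmul (F a) (lookupD (invRows F n) (n ∸ (suc n ∸ a))) k)
      ≡⟨ T.∑-suc n _ ⟩
    + 0 ℤ.+ T.∑ n (λ a → tmul (F (suc a)) (lookupD (invRows F n) (n ∸ (n ∸ a))) k)
      ≡⟨ ℤ.+-identityˡ _ ⟩
    T.∑ n (λ a → tmul (F (suc a)) (lookupD (invRows F n) (n ∸ (n ∸ a))) k)
      ≡⟨ T.∑-cong n (λ a a≤n → ≡.trans (sumTo≡∑ k _)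
           (cong (λ g → (F (suc a) T.⋆ g) k) (invRows-lookup F n (n ∸ a) (ℕ.m∸n≤m n a)))) ⟩
    T.∑ n (λ a → (F (suc a) T.⋆ inv F (n ∸ a)) k) ∎)
    where open ≡.≡-Reasoning

  inv-zero : ∀ F → inv F 0 ≈ₜ 1ₜ
  inv-zero F zero    = refl
  inv-zero F (suc k) = refl

  *-inverseʳ : ∀ F → F 0 ≈ₜ 1ₜ → F * inv F ≈ 1#
  *-inverseʳ F F₀≈1 zero = Tₛ.trans (Tₛ.*-cong F₀≈1 (inv-zero F)) (Tₛ.*-identityˡ 1ₜ)
  *-inverseʳ F F₀≈1 (suc n) k = begin
    (F Q.⋆ inv F) (suc n) k
      ≡⟨ Q.∑-suc n _ k ⟩
    (F 0 T.⋆ inv F (suc n)) k ℤ.+ Q.∑ n (λ a → F (suc a) T.⋆ inv F (n ∸ a)) k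
      ≡⟨ cong₂ ℤ._+_ (≡.trans (Tₛ.*-congʳ {inv F (suc n)} F₀≈1 k) (T.⋆-identityˡ (inv F (suc n)) k))
                     (∑-apply n _ k) ⟩
    inv F (suc n) k ℤ.+ S
      ≡⟨ cong (ℤ._+ S) (inv-suc F n k) ⟩
    ℤ.- S ℤ.+ S
      ≡⟨ ℤ.+-inverseˡ S ⟩
    + 0 ∎
    where
    open ≡.≡-Reasoning
    S = T.∑ n (λ a → (F (suc a) T.⋆ inv F (n ∸ a)) k)

  inv-≈[]-1# : ∀ F N → F ≈[ N ] 1# → inv F ≈[ N ] 1#
  inv-≈[]-1# F N F≈1 zero    _       = inv-zero F
  inv-≈[]-1# F N F≈1 (suc n) 1+n≤N k = ≡.trans (inv-suc F n k) (cong ℤ.-_ (≡.trans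
    (T.∑-cong n (λ a a≤n → ≡.trans
      (T.∑-cong′ k (λ b → cong (ℤ._* inv F (n ∸ a) (k ∸ b)) (F≈1 (suc a) (ℕ.≤-trans (s≤s a≤n) 1+n≤N) b)))
      (T.∑-zero k)))
    (T.∑-zero n)))

  shift : ℕ → ℕ → PS → PS
  shift i j X n k = if (i ≤ᵇ n) ∧ (j ≤ᵇ k) then X (n ∸ i) (k ∸ j) else + 0

  mono≈single : ∀ i j → mono i j ≈ Q.single i (T.single j (+ 1))
  mono≈single i j n k with n ≡ᵇ i
  ... | true  = refl
  ... | false = refl

  mono*≡shift : ∀ i j X n k → (mono i j * X) n k ≡ shift i j X n k
  mono*≡shift i j X n k = ≡.trans (*-congʳ {X} (mono≈single i j) n k)
    (≡.trans (Q.single-⋆ i (T.single j (+ 1)) X n k) shifted)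
    where
    shifted : (if i ≤ᵇ n then T.single j (+ 1) T.⋆ X (n ∸ i) else (λ _ → + 0)) k ≡ shift i j X n k
    shifted with i ≤ᵇ n
    ... | false = refl
    ... | true  = ≡.trans (T.single-⋆ j (+ 1) (X (n ∸ i)) k) one*
      where
      one* : (if j ≤ᵇ k then + 1 ℤ.* X (n ∸ i) (k ∸ j) else + 0) ≡ (if j ≤ᵇ k then X (n ∸ i) (k ∸ j) else + 0)
      one* with j ≤ᵇ k
      ... | true  = ℤ.*-identityˡ _
      ... | false = refl

  binomial : ℕ → ℕ → PS
  binomial i j = one ⊝ mono i j

  binomial*≈ : ∀ i j X → binomial i j * X ≈ X + - (mono i j * X)
  binomial*≈ i j X = begin
    (one + - mono i j) * X        ≈⟨ distribʳ X one (- mono i j) ⟩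
    one * X + - mono i j * X      ≈⟨ +-cong (≈-trans (*-congʳ {X} one≈1#) (*-identityˡ X)) (≈-sym (-‿distribˡ-* (mono i j) X)) ⟩
    X + - (mono i j * X)          ∎
    where
    open import Relation.Binary.Reasoning.Setoid setoid
    open import Algebra.Properties.Ring ring using (-‿distribˡ-*)

  binomial≈[]1# : ∀ i j → binomial (suc i) j ≈[ i ] 1#
  binomial≈[]1# i j a a≤i k = ≡.trans
    (cong (λ b → one a k ℤ.- (if b ∧ (k ≡ᵇ j) then + 1 else + 0)) (≢⇒≡ᵇ≡false (λ a≡1+i → ℕ.<-irrefl a≡1+i (s≤s a≤i))))
    (≡.trans (ℤ.+-identityʳ (one a k)) (one≈1# a k))

  factor≈[]1# : ∀ m → factor (suc m) ≈[ 3 ℕ.* suc m ∸ 1 ] 1#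
  factor≈[]1# m a a≤N k = ≡.trans (⊛≈* (binomial (3 ℕ.* suc m) m) (inv (binomial (3 ℕ.* suc m) (suc m))) a k)
    (≡.trans (*-cong-≈[] N (binomial≈[]1# N m) (inv-≈[]-1# _ N (binomial≈[]1# N (suc m))) a a≤N k)
             (*-identityˡ 1# a k))
    where
    N = 3 ℕ.* suc m ∸ 1

  prodTo≈[]prodTo : ∀ i n → i ≤ n → prodTo n ≈[ i ] prodTo i
  prodTo≈[]prodTo i n i≤n with ℕ.m≤n⇒m<n∨m≡n i≤n
  ... | inj₂ refl = λ _ _ _ → refl
  prodTo≈[]prodTo i (suc n) _ | inj₁ (s≤s i≤n) = λ a a≤i k → begin
    (prodTo n ⊛ factor (suc n)) a k   ≡⟨ ⊛≈* (prodTo n) (factor (suc n)) a k ⟩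
    (prodTo n * factor (suc n)) a k   ≡⟨ *-cong-≈[] {prodTo n} i (λ _ _ _ → refl)
                                           (≈[]-weaken (ℕ.≤-trans i≤n (ℕ.m≤m+n n _)) (factor≈[]1# n)) a a≤i k ⟩
    (prodTo n * 1#) a k               ≡⟨ *-identityʳ (prodTo n) a k ⟩
    prodTo n a k                      ≡⟨ prodTo≈[]prodTo i n i≤n a a≤i k ⟩
    prodTo i a k                      ∎
    where open ≡.≡-Reasoning

  infProd≈[]prodTo : ∀ n → infProd ≈[ n ] prodTo n
  infProd≈[]prodTo n a a≤n k = ≡.sym (prodTo≈[]prodTo a n a≤n a ℕ.≤-refl k)

  open Combinatorics using (countReduced; countReduced-large; countReduced-suc; insertTriple;
                            wtZ3-insertTriple; wtZ3~-insertTriple; countReduced-wtZ3~≡wtZ3)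

  reducedSeries : (List ℕ → ℕ) → ℕ → PS
  reducedSeries w M n k = + countReduced w M n k

  reducedSeries≈[]genSeries : ∀ w N → reducedSeries w N ≈[ N ] genSeries w
  reducedSeries≈[]genSeries w N n n≤N k = cong +_ (countReduced-large w N n k n≤N)

  binomial*reducedSeries : ∀ (w : List ℕ → ℕ) (d : ℕ → ℕ) → (∀ M l → w (insertTriple M l) ≡ d M ℕ.+ w l) →
    ∀ m → binomial (3 ℕ.* suc m) (d (suc m)) * reducedSeries w (suc m) ≈ reducedSeries w m
  binomial*reducedSeries w d w-insertTriple m n k = begin
    (binomial i j * X) n k                        ≡⟨ binomial*≈ i j X n k ⟩
    X n k ℤ.+ ℤ.- (mono i j * X) n k              ≡⟨ cong (λ z → X n k ℤ.+ ℤ.- z) (mono*≡shift i j X n k) ⟩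
    X n k ℤ.+ ℤ.- shift i j X n k                 ≡⟨ cong (λ z → z ℤ.+ ℤ.- shift i j X n k) (≡.trans
                                                       (cong +_ (countReduced-suc w d w-insertTriple m n k))
                                                       (≡.trans (ℤ.pos-+ (countReduced w m n k) _) (cong (λ z → reducedSeries w m n k ℤ.+ z) shift≡))) ⟩
    reducedSeries w m n k ℤ.+ S ℤ.+ ℤ.- S         ≡⟨ ℤ.+-assoc (reducedSeries w m n k) S (ℤ.- S) ⟩
    reducedSeries w m n k ℤ.+ (S ℤ.+ ℤ.- S)       ≡⟨ cong (λ z → reducedSeries w m n k ℤ.+ z) (ℤ.+-inverseʳ S) ⟩
    reducedSeries w m n k ℤ.+ + 0                 ≡⟨ ℤ.+-identityʳ _ ⟩
    reducedSeries w m n k                         ∎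
    where
    open ≡.≡-Reasoning
    i = 3 ℕ.* suc m
    j = d (suc m)
    X = reducedSeries w (suc m)
    S = shift i j X n k
    shift≡ : + (if (i ≤ᵇ n) ∧ (j ≤ᵇ k) then countReduced w (suc m) (n ∸ i) (k ∸ j) else 0) ≡ S
    shift≡ with (i ≤ᵇ n) ∧ (j ≤ᵇ k)
    ... | true  = refl
    ... | false = refl

  prodTo*reducedSeries : ∀ N → prodTo N * reducedSeries wtZ3 N ≈ reducedSeries wtZ3~ N
  prodTo*reducedSeries zero =
    ≈-trans (*-congʳ {reducedSeries wtZ3 0} one≈1#)
      (≈-trans (*-identityˡ _) (λ n k → cong +_ (≡.sym (countReduced-wtZ3~≡wtZ3 n k))))
  prodTo*reducedSeries (suc N) = begin
    prodTo (suc N) * R⁺                   ≈⟨ *-congʳ {R⁺} (≈-trans (⊛≈* P (factor (suc N))) (*-congˡ {P} (⊛≈* b⁺ I))) ⟩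
    (P * (b⁺ * I)) * R⁺                   ≈⟨ *-congʳ {R⁺} (x∙yz≈z∙xy P b⁺ I) ⟩
    (I * (P * b⁺)) * R⁺                   ≈⟨ *-assoc I (P * b⁺) R⁺ ⟩
    I * ((P * b⁺) * R⁺)                   ≈⟨ *-congˡ {I} (*-assoc P b⁺ R⁺) ⟩
    I * (P * (b⁺ * R⁺))                   ≈⟨ *-congˡ {I} (*-congˡ {P} (binomial*reducedSeries wtZ3 (_∸ 1) wtZ3-insertTriple N)) ⟩
    I * (P * reducedSeries wtZ3 N)        ≈⟨ *-congˡ {I} (prodTo*reducedSeries N) ⟩
    I * reducedSeries wtZ3~ N             ≈⟨ *-congˡ {I} (binomial*reducedSeries wtZ3~ (λ M → M) wtZ3~-insertTriple N) ⟨
    I * (b~ * R~)                         ≈⟨ x∙yz≈yx∙z I b~ R~ ⟩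
    (b~ * I) * R~                         ≈⟨ *-congʳ {R~} (*-inverseʳ b~ (binomial≈[]1# (3 ℕ.* suc N ∸ 1) (suc N) 0 z≤n)) ⟩
    1# * R~                               ≈⟨ *-identityˡ R~ ⟩
    R~                                    ∎
    where
    open import Relation.Binary.Reasoning.Setoid setoid
    open import Algebra.Properties.CommutativeSemigroup *-commutativeSemigroup using (x∙yz≈z∙xy; x∙yz≈yx∙z)
    P = prodTo N
    b⁺ = binomial (3 ℕ.* suc N) N
    b~ = binomial (3 ℕ.* suc N) (suc N)
    I = inv b~
    R⁺ = reducedSeries wtZ3 (suc N)
    R~ = reducedSeries wtZ3~ (suc N)

open BivariateSeries

proposition2p1 : (n k : ℕ) →
    genSeries wtZ3~ n k ≡ (infProd ⊛ genSeries wtZ3) n k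
proposition2p1 n k = begin
  genSeries wtZ3~ n k                  ≡⟨ reducedSeries≈[]genSeries wtZ3~ n n ℕ.≤-refl k ⟨
  reducedSeries wtZ3~ n n k            ≡⟨ prodTo*reducedSeries n n k ⟨
  (prodTo n Q.⋆ reducedSeries wtZ3 n) n k
    ≡⟨ *-cong-≈[] {prodTo n} {prodTo n} n (λ _ _ _ → ≡.refl) (reducedSeries≈[]genSeries wtZ3 n) n ℕ.≤-refl k ⟩
  (prodTo n Q.⋆ genSeries wtZ3) n k
    ≡⟨ *-cong-≈[] {prodTo n} {infProd} {genSeries wtZ3} {genSeries wtZ3} n (λ a a≤n k′ → ≡.sym (infProd≈[]prodTo n a a≤n k′)) (λ _ _ _ → ≡.refl) n ℕ.≤-refl k ⟩
  (infProd Q.⋆ genSeries wtZ3) n k       ≡⟨ ⊛≈* infProd (genSeries wtZ3) n k ⟨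
  (infProd ⊛ genSeries wtZ3) n k       ∎
  where open ≡.≡-Reasoning
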